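{- For all formulae $\alpha,\beta$ of $\mathbf{PDBL}$, the following two rules are derivable in $\mathbf{PDBL}$ (the conclusion can be derived from the premise using the axioms and rules of $\mathbf{PDBL}$): (R10) from $\alpha\sqcap\neg\beta\vdash\alpha$ infer $\bot\vdash\alpha\sqcap\beta$; (R11) from $\alpha\vdash\alpha\sqcap\neg\beta$ infer $\alpha\sqcap\beta\vdash\bot$.
   Context: The logic PDBL. Variables: object variables $\mathbf{OV}$ ($p,\dots$) and property variables $\mathbf{PV}$ ($P,\dots$), disjoint countably infinite sets; constants $\top,\bot$; connectives $\sqcap,\sqcup$ (binary), $\neg,\lrcorner$ (unary). $\alpha\vee\beta:=\neg(\neg\alpha\sqcap\neg\beta)$, $\alpha\wedge\beta:=\lrcorner(\lrcorner\alpha\sqcup\lrcorner\beta)$. Sequents $\alpha\vdash\beta$ ($\alpha\dashv\vdash\beta$ means both directions); s-hypersequents are finite sequences $\alpha_1\vdash\beta_1\mid\dots\mid\alpha_n\vdash\beta_n$ (components); $B,C,\dots,X$ range over possibly empty s-hypersequents. Axioms: $\alpha\vdash\alpha$; $\alpha\sqcap\beta\vdash\alpha$; $\alpha\sqcap\beta\vdash\beta$; $\alpha\vdash\alpha\sqcup\beta$; $\beta\vdash\alpha\sqcup\beta$; $\alpha\sqcap\beta\vdash(\alpha\sqcap\beta)\sqcap(\alpha\sqcap\beta)$; $(\alpha\sqcup\beta)\sqcup(\alpha\sqcup\beta)\vdash\alpha\sqcup\beta$; $\neg(\alpha\sqcap\alpha)\vdash\neg\alpha$; $\lrcorner\alpha\vdash\lrcorner(\alpha\sqcup\alpha)$;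 $\alpha\sqcap\neg\alpha\vdash\bot$; $\top\vdash\alpha\sqcup\lrcorner\alpha$; $\neg\neg(\alpha\sqcap\beta)\dashv\vdash\alpha\sqcap\beta$; $\lrcorner\lrcorner(\alpha\sqcup\beta)\dashv\vdash\alpha\sqcup\beta$; $\alpha\sqcap\alpha\vdash\alpha\sqcap(\alpha\sqcup\beta)$; $\alpha\sqcup(\alpha\sqcap\beta)\vdash\alpha\sqcup\alpha$; $\alpha\sqcap\alpha\vdash\alpha\sqcap(\alpha\vee\beta)$; $\alpha\sqcup(\alpha\wedge\beta)\vdash\alpha\sqcup\alpha$; $\alpha\sqcap(\beta\vee\gamma)\dashv\vdash(\alpha\sqcap\beta)\vee(\alpha\sqcap\gamma)$; $\alpha\sqcup(\beta\wedge\gamma)\dashv\vdash(\alpha\sqcup\beta)\wedge(\alpha\sqcup\gamma)$; $\bot\vdash\alpha$; $\alpha\vdash\top$; $\neg\top\vdash\bot$; $\top\vdash\lrcorner\bot$; $\neg\bot\dashv\vdash\top\sqcap\top$; $\lrcorner\top\dashv\vdash\bot\sqcup\bot$; $(\alpha\sqcup\alpha)\sqcap(\alpha\sqcup\alpha)\dashv\vdash(\alpha\sqcap\alpha)\sqcup(\alpha\sqcap\alpha)$; $p\sqcap p\dashv\vdash p$ ($p\in\mathbf{OV}$); $P\sqcup P\dashv\vdash P$ ($P\in\mathbf{PV}$); (Sp) $\alpha\vdash\alpha\sqcap\alpha\mid\alpha\sqcup\alpha\vdash\alpha$. Rules: from $B\mid\alpha\vdash\beta\mid C$ infer $B\mid\alpha\sqcap\gamma\vdash\beta\sqcap\gamma\mid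 C$, $B\mid\gamma\sqcap\alpha\vdash\gamma\sqcap\beta\mid C$, $B\mid\alpha\sqcup\gamma\vdash\beta\sqcup\gamma\mid C$, $B\mid\gamma\sqcup\alpha\vdash\gamma\sqcup\beta\mid C$, $B\mid\neg\beta\vdash\neg\alpha\mid C$, $B\mid\lrcorner\beta\vdash\lrcorner\alpha\mid C$; from $B\mid\alpha\vdash\beta\mid C$ and $D\mid\beta\vdash\gamma\mid E$ infer $B\mid D\mid\alpha\vdash\gamma\mid C\mid E$; from $B\mid\alpha\sqcap\beta\vdash\alpha\sqcap\alpha\mid C$, $D\mid\alpha\sqcap\alpha\vdash\alpha\sqcap\beta\mid E$, $F\mid\alpha\sqcup\beta\vdash\beta\sqcup\beta\mid G$, $H\mid\beta\sqcup\beta\vdash\alpha\sqcup\beta\mid X$ infer $B\mid D\mid F\mid H\mid\alpha\vdash\beta\mid C\mid E\mid G\mid X$; external: from $B\mid D\mid D\mid C$ infer $B\mid D\mid C$; from $B\mid D\mid E\mid C$ infer $B\mid E\mid D\mid C$; from $B$ infer $B\mid C$. -}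

module Defs where

open import Data.Nat using (ℕ)
open import Data.List using (List; []; _∷_; _++_; [_])
open import Data.Product using (_×_; _,_)
open import Relation.Binary.PropositionalEquality using (_≡_)

infixl 7 _⊓_
infixl 6 _⊔_
data Fm : Set where
  ovar pvar : ℕ → Fm
  ⊤' ⊥'     : Fm
  _⊓_ _⊔_   : Fm → Fm → Fm
  ¬'_ ⌟_    : Fm → Fm

infix 9 ¬'_ ⌟_

_∨'_ : Fm → Fm → Fm
a ∨' b = ¬' (¬' a ⊓ ¬' b)

_∧'_ : Fm → Fm → Fm
a ∧' b = ⌟ (⌟ a ⊔ ⌟ b)

infix 4 _⊢_
data Seq : Set where
  _⊢_ : Fm → Fm → Seq


SHS : Set
SHS = List Seq

-- Axioms of PDBL (each a one-component s-hypersequent, except (Sp)).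
-- α ⊣⊢ β is recorded as two axioms α ⊢ β and β ⊢ α.
data Axiom : SHS → Set where
  ax-id      : ∀ a → Axiom [ a ⊢ a ]
  ax-⊓l      : ∀ a b → Axiom [ a ⊓ b ⊢ a ]
  ax-⊓r      : ∀ a b → Axiom [ a ⊓ b ⊢ b ]
  ax-⊔l      : ∀ a b → Axiom [ a ⊢ a ⊔ b ]
  ax-⊔r      : ∀ a b → Axiom [ b ⊢ a ⊔ b ]
  ax-⊓dup    : ∀ a b → Axiom [ a ⊓ b ⊢ (a ⊓ b) ⊓ (a ⊓ b) ]
  ax-⊔dup    : ∀ a b → Axiom [ (a ⊔ b) ⊔ (a ⊔ b) ⊢ a ⊔ b ]
  ax-¬⊓      : ∀ a → Axiom [ ¬' (a ⊓ a) ⊢ ¬' a ]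
  ax-⌟⊔      : ∀ a → Axiom [ ⌟ a ⊢ ⌟ (a ⊔ a) ]
  ax-contr   : ∀ a → Axiom [ a ⊓ ¬' a ⊢ ⊥' ]
  ax-exmid   : ∀ a → Axiom [ ⊤' ⊢ a ⊔ ⌟ a ]
  ax-¬¬₁     : ∀ a b → Axiom [ ¬' ¬' (a ⊓ b) ⊢ a ⊓ b ]
  ax-¬¬₂     : ∀ a b → Axiom [ a ⊓ b ⊢ ¬' ¬' (a ⊓ b) ]
  ax-⌟⌟₁     : ∀ a b → Axiom [ ⌟ ⌟ (a ⊔ b) ⊢ a ⊔ b ]
  ax-⌟⌟₂     : ∀ a b → Axiom [ a ⊔ b ⊢ ⌟ ⌟ (a ⊔ b) ]
  ax-abs⊓    : ∀ a b → Axiom [ a ⊓ a ⊢ a ⊓ (a ⊔ b) ]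
  ax-abs⊔    : ∀ a b → Axiom [ a ⊔ (a ⊓ b) ⊢ a ⊔ a ]
  ax-abs∨    : ∀ a b → Axiom [ a ⊓ a ⊢ a ⊓ (a ∨' b) ]
  ax-abs∧    : ∀ a b → Axiom [ a ⊔ (a ∧' b) ⊢ a ⊔ a ]
  ax-dist⊓₁  : ∀ a b c → Axiom [ a ⊓ (b ∨' c) ⊢ (a ⊓ b) ∨' (a ⊓ c) ]
  ax-dist⊓₂  : ∀ a b c → Axiom [ (a ⊓ b) ∨' (a ⊓ c) ⊢ a ⊓ (b ∨' c) ]
  ax-dist⊔₁  : ∀ a b c → Axiom [ a ⊔ (b ∧' c) ⊢ (a ⊔ b) ∧' (a ⊔ c) ]
  ax-dist⊔₂  : ∀ a b c → Axiom [ (a ⊔ b) ∧' (a ⊔ c) ⊢ a ⊔ (b ∧' c) ]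
  ax-⊥       : ∀ a → Axiom [ ⊥' ⊢ a ]
  ax-⊤       : ∀ a → Axiom [ a ⊢ ⊤' ]
  ax-¬⊤      : Axiom [ ¬' ⊤' ⊢ ⊥' ]
  ax-⌟⊥      : Axiom [ ⊤' ⊢ ⌟ ⊥' ]
  ax-¬⊥₁     : Axiom [ ¬' ⊥' ⊢ ⊤' ⊓ ⊤' ]
  ax-¬⊥₂     : Axiom [ ⊤' ⊓ ⊤' ⊢ ¬' ⊥' ]
  ax-⌟⊤₁     : Axiom [ ⌟ ⊤' ⊢ ⊥' ⊔ ⊥' ]
  ax-⌟⊤₂     : Axiom [ ⊥' ⊔ ⊥' ⊢ ⌟ ⊤' ]
  ax-mix₁    : ∀ a → Axiom [ (a ⊔ a) ⊓ (a ⊔ a) ⊢ (a ⊓ a) ⊔ (a ⊓ a) ]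
  ax-mix₂    : ∀ a → Axiom [ (a ⊓ a) ⊔ (a ⊓ a) ⊢ (a ⊔ a) ⊓ (a ⊔ a) ]
  ax-ov₁     : ∀ p → Axiom [ ovar p ⊓ ovar p ⊢ ovar p ]
  ax-ov₂     : ∀ p → Axiom [ ovar p ⊢ ovar p ⊓ ovar p ]
  ax-pv₁     : ∀ P → Axiom [ pvar P ⊔ pvar P ⊢ pvar P ]
  ax-pv₂     : ∀ P → Axiom [ pvar P ⊢ pvar P ⊔ pvar P ]
  ax-Sp      : ∀ a → Axiom ((a ⊢ a ⊓ a) ∷ (a ⊔ a ⊢ a) ∷ [])

data Deriv (Hyp : SHS → Set) : SHS → Set where
  hyp   : ∀ {H} → Hyp H → Deriv Hyp H
  axiom : ∀ {H} → Axiom H → Deriv Hyp H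
  mon⊓r : ∀ B C a b c → Deriv Hyp (B ++ (a ⊢ b) ∷ C) → Deriv Hyp (B ++ (a ⊓ c ⊢ b ⊓ c) ∷ C)
  mon⊓l : ∀ B C a b c → Deriv Hyp (B ++ (a ⊢ b) ∷ C) → Deriv Hyp (B ++ (c ⊓ a ⊢ c ⊓ b) ∷ C)
  mon⊔r : ∀ B C a b c → Deriv Hyp (B ++ (a ⊢ b) ∷ C) → Deriv Hyp (B ++ (a ⊔ c ⊢ b ⊔ c) ∷ C)
  mon⊔l : ∀ B C a b c → Deriv Hyp (B ++ (a ⊢ b) ∷ C) → Deriv Hyp (B ++ (c ⊔ a ⊢ c ⊔ b) ∷ C)
  anti¬ : ∀ B C a b → Deriv Hyp (B ++ (a ⊢ b) ∷ C) → Deriv Hyp (B ++ (¬' b ⊢ ¬' a) ∷ C)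
  anti⌟ : ∀ B C a b → Deriv Hyp (B ++ (a ⊢ b) ∷ C) → Deriv Hyp (B ++ (⌟ b ⊢ ⌟ a) ∷ C)
  cut   : ∀ B C D E a b c →
          Deriv Hyp (B ++ (a ⊢ b) ∷ C) → Deriv Hyp (D ++ (b ⊢ c) ∷ E) →
          Deriv Hyp (B ++ D ++ (a ⊢ c) ∷ C ++ E)
  eq    : ∀ B C D E F G H X a b →
          Deriv Hyp (B ++ (a ⊓ b ⊢ a ⊓ a) ∷ C) →
          Deriv Hyp (D ++ (a ⊓ a ⊢ a ⊓ b) ∷ E) →
          Deriv Hyp (F ++ (a ⊔ b ⊢ b ⊔ b) ∷ G) →
          Deriv Hyp (H ++ (b ⊔ b ⊢ a ⊔ b) ∷ X) →
          Deriv Hyp (B ++ D ++ F ++ H ++ (a ⊢ b) ∷ C ++ E ++ G ++ X)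
  ec    : ∀ B C D → Deriv Hyp (B ++ D ++ D ++ C) → Deriv Hyp (B ++ D ++ C)
  ee    : ∀ B C D E → Deriv Hyp (B ++ D ++ E ++ C) → Deriv Hyp (B ++ E ++ D ++ C)
  ew    : ∀ B C → Deriv Hyp B → Deriv Hyp (B ++ C)

Only : SHS → SHS → Set
Only S H = H ≡ S

DerivableRule : Seq → Seq → Set
DerivableRule S T = Deriv (Only [ S ]) [ T ]

{-# OPTIONS --safe #-}
module Submission where

open import Defs
open import Data.Product using (_×_; _,_)
open import Data.List using ([]; [_])
open import Relation.Binary.PropositionalEquality using (refl)

-- R10 holds outright since ⊥ ⊢ a ⊓ b is an axiom. For R11, the premise
-- gives a ⊓ b ⊢ a ⊢ a ⊓ ¬ b ⊢ ¬ b; since meets (unlike arbitrary formulae)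
-- are duplicable, a ⊓ b ⊢ b ⊓ ¬ b ⊢ ⊥.

module _ {Hyp : SHS → Set} where

  infixr 5 _⨾_
  _⨾_ : ∀ {a b c} → Deriv Hyp [ a ⊢ b ] → Deriv Hyp [ b ⊢ c ] → Deriv Hyp [ a ⊢ c ]
  _⨾_ {a} {b} {c} = cut [] [] [] [] a b c

  ⊓-monoˡ : ∀ {a b} c → Deriv Hyp [ a ⊢ b ] → Deriv Hyp [ a ⊓ c ⊢ b ⊓ c ]
  ⊓-monoˡ {a} {b} c = mon⊓r [] [] a b c

  ⊓-monoʳ : ∀ {a b} c → Deriv Hyp [ a ⊢ b ] → Deriv Hyp [ c ⊓ a ⊢ c ⊓ b ]
  ⊓-monoʳ {a} {b} c = mon⊓l [] [] a b c

  meet-⊓-intro : ∀ {a b x y} →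
                 Deriv Hyp [ a ⊓ b ⊢ x ] → Deriv Hyp [ a ⊓ b ⊢ y ] →
                 Deriv Hyp [ a ⊓ b ⊢ x ⊓ y ]
  meet-⊓-intro {a} {b} {x} {y} ⊢x ⊢y =
    axiom (ax-⊓dup a b) ⨾ ⊓-monoˡ (a ⊓ b) ⊢x ⨾ ⊓-monoʳ x ⊢y

  meet-⊢¬-refutes : ∀ {a b} → Deriv Hyp [ a ⊓ b ⊢ ¬' b ] → Deriv Hyp [ a ⊓ b ⊢ ⊥' ]
  meet-⊢¬-refutes {a} {b} ⊢¬b =
    meet-⊓-intro (axiom (ax-⊓r a b)) ⊢¬b ⨾ axiom (ax-contr b)

theorem92 : (a b : Fm) →
    DerivableRule (a ⊓ ¬' b ⊢ a) (⊥' ⊢ a ⊓ b) ×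
    DerivableRule (a ⊢ a ⊓ ¬' b) (a ⊓ b ⊢ ⊥')
theorem92 a b = axiom (ax-⊥ (a ⊓ b)) , r11
  where
  r11 : DerivableRule (a ⊢ a ⊓ ¬' b) (a ⊓ b ⊢ ⊥')
  r11 = meet-⊢¬-refutes (axiom (ax-⊓l a b) ⨾ hyp refl ⨾ axiom (ax-⊓r a (¬' b)))
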